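{- For all integers $n,k\ge0$, $\sum_{\lambda\in\widetilde{\mathcal{T}}_n^k}x^{w_{\widetilde{\mathcal{T}}}^{\leftarrow}(\lambda)}=\sum_{\lambda\in\widetilde{\mathcal{T}}_n^k}x^{w_{\widetilde{\mathcal{T}}}^{\downarrow}(\lambda)}$.
   Context: $\widetilde{\mathcal{T}}_n^k$ (packed alternative tableaux of rectangular shape $n\times k$): partial fillings of the cells of an $(n+1)\times(k+1)$ rectangle with left arrows $\leftarrow$ and down arrows $\downarrow$ such that every cell pointed to by an arrow (strictly left of a $\leftarrow$ in its row, or strictly below a $\downarrow$ in its column) is empty, each row except the bottom row contains exactly one $\leftarrow$, each column except the leftmost column contains exactly one $\downarrow$, the bottom row contains no $\leftarrow$, and the leftmost column contains no $\downarrow$. $w_{\widetilde{\mathcal{T}}}^{\leftarrow}(\lambda)$ is the number of columns that contain a $\leftarrow$ and whose $\downarrow$ lies in the bottom row; $w_{\widetilde{\mathcal{T}}}^{\downarrow}(\lambda)$ is the number of rows that contain a $\downarrow$ and whose $\leftarrow$ lies in the leftmost column. -}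

module Defs where

open import Level using (0ℓ)
open import Data.Bool using (Bool; true; false; _∧_; _∨_; not; if_then_else_)
open import Data.Nat using (ℕ; zero; suc; _≡ᵇ_; _<ᵇ_)
open import Data.Fin using (Fin; toℕ)
open import Data.List using (List; []; _∷_; map; concatMap; length; filterᵇ; foldr; allFin)
open import Data.Vec using (Vec; lookup) renaming ([] to []ᵛ; _∷_ to _∷ᵛ_)
open import Algebra.Bundles using (CommutativeSemiring)

data Arrow : Set where
  blank left down : Arrow

isBlank isLeft isDown : Arrow → Bool
isBlank blank = true
isBlank _     = false
isLeft left = true
isLeft _    = false
isDown down = true
isDown _    = false

-- A (partial) filling of the (n+1)×(k+1) rectangle.
-- Row index i : Fin (suc n), with i = 0 the BOTTOM row (rows numbered upwards).
-- Column index j : Fin (suc k), with j = 0 the LEFTMOST column.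
Filling : ℕ → ℕ → Set
Filling n k = Vec (Vec Arrow (suc k)) (suc n)

cell : ∀ {n k} → Filling n k → Fin (suc n) → Fin (suc k) → Arrow
cell T i j = lookup (lookup T i) j

allVecs : {A : Set} → List A → (m : ℕ) → List (Vec A m)
allVecs xs zero    = []ᵛ ∷ []
allVecs xs (suc m) = concatMap (λ x → map (x ∷ᵛ_) (allVecs xs m)) xs

allArrows : List Arrow
allArrows = blank ∷ left ∷ down ∷ []

allFillings : (n k : ℕ) → List (Filling n k)
allFillings n k = allVecs (allVecs allArrows (suc k)) (suc n)

countᵇ : {A : Set} → (A → Bool) → List A → ℕ
countᵇ p xs = length (filterᵇ p xs)

isZeroFin : ∀ {m} → Fin m → Bool
isZeroFin j = toℕ j ≡ᵇ 0

allᵇ : {A : Set} → (A → Bool) → List A → Bool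
allᵇ p xs = foldr (λ x b → p x ∧ b) true xs

anyᵇ : {A : Set} → (A → Bool) → List A → Bool
anyᵇ p xs = foldr (λ x b → p x ∨ b) false xs

_⇒ᵇ_ : Bool → Bool → Bool
a ⇒ᵇ b = not a ∨ b

module _ {n k : ℕ} (T : Filling n k) where
  rows : List (Fin (suc n))
  rows = allFin (suc n)
  cols : List (Fin (suc k))
  cols = allFin (suc k)

  leftPointsEmpty : Bool
  leftPointsEmpty = allᵇ (λ i → allᵇ (λ j → isLeft (cell T i j) ⇒ᵇ
      allᵇ (λ j' → (toℕ j' <ᵇ toℕ j) ⇒ᵇ isBlank (cell T i j')) cols) cols) rows

  downPointsEmpty : Bool
  downPointsEmpty = allᵇ (λ i → allᵇ (λ j → isDown (cell T i j) ⇒ᵇ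
      allᵇ (λ i' → (toℕ i' <ᵇ toℕ i) ⇒ᵇ isBlank (cell T i' j)) rows) cols) rows

  leftsInRow : Fin (suc n) → ℕ
  leftsInRow i = countᵇ (λ j → isLeft (cell T i j)) cols

  downsInCol : Fin (suc k) → ℕ
  downsInCol j = countᵇ (λ i → isDown (cell T i j)) rows

  rowCondition : Bool
  rowCondition = allᵇ (λ i → if isZeroFin i then leftsInRow i ≡ᵇ 0 else leftsInRow i ≡ᵇ 1) rows

  colCondition : Bool
  colCondition = allᵇ (λ j → if isZeroFin j then downsInCol j ≡ᵇ 0 else downsInCol j ≡ᵇ 1) cols

  isPackedAltTableau : Bool
  isPackedAltTableau = leftPointsEmpty ∧ downPointsEmpty ∧ rowCondition ∧ colCondition

  wLeft : ℕ
  wLeft = countᵇ (λ j → anyᵇ (λ i → isLeft (cell T i j)) rows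
                        ∧ isDown (cell T Data.Fin.zero j)) cols

  wDown : ℕ
  wDown = countᵇ (λ i → anyᵇ (λ j → isDown (cell T i j)) cols
                        ∧ isLeft (cell T i Data.Fin.zero)) rows

-- the set \widetilde{T}_n^k, as a (duplicate-free) list
packedAltTableaux : (n k : ℕ) → List (Filling n k)
packedAltTableaux n k = filterᵇ isPackedAltTableau (allFillings n k)

module _ (R : CommutativeSemiring 0ℓ 0ℓ) where
  open CommutativeSemiring R
  pow : Carrier → ℕ → Carrier
  pow x zero    = 1#
  pow x (suc m) = x * pow x m

  genSum : (n k : ℕ) → (Filling n k → ℕ) → Carrier → Carrier
  genSum n k w x = foldr (λ T acc → pow x (w T) + acc) 0# (packedAltTableaux n k)

-- A packed alternative tableau is determined by r, the column of the ← in each row above the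
-- bottom one, and c, the row of the ↓ in each column right of the leftmost one; the pointing
-- conditions say exactly that a ← lies left of every ↓ in its row and a ↓ lies below every ← in
-- its column. Call (i, j) a corner if the ← of row i is in the leftmost column and j is the
-- leftmost column with a ↓ in row i, and a mirrored corner if the ↓ of column j is in the bottom
-- row and i is the lowest row with a ← in column j. Then w↓ counts the rows having a corner and
-- w← the columns having a mirrored corner. Moving, at every corner, the ← onto the corner's
-- column and that column's ↓ down to the bottom row, and undoing this at every mirrored corner,
-- turns corners into mirrored corners and back; it is an involution of the tableaux. Since a
-- mirrored corner is determined both by its row and by its column, the involution exchanges w←
-- and w↓, so the two generating functions agree.

module Submission where

open import Defs
open import Level using (0ℓ)
open import Algebra.Bundles using (CommutativeMonoid; CommutativeSemiring)
open import Data.Bool using (Bool; true; false; T; _∧_; _∨_; if_then_else_)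
open import Data.Bool.Properties using (T-≡; T-∧; T-∨; ∧-zeroʳ)
open import Data.Empty using (⊥-elim)
open import Data.Fin using (Fin; zero; suc; _<_; _≟_)
open import Data.Fin.Properties using (suc-injective; 0≢1+n; <-irrefl; <-asym; <-cmp)
open import Data.List using (List; []; _∷_; _++_; map; concatMap; foldr; cartesianProductWith; tabulate; allFin)
open import Data.List.Properties using (map-∘; map-cong-local; foldr-map)
open import Data.List.Membership.Propositional using (_∈_)
open import Data.List.Membership.Propositional.Properties
  using (∈-map⁺; ∈-map⁻; ∈-cartesianProductWith⁺; ∈-filter⁺; ∈-filter⁻)
open import Data.List.Membership.Propositional.Properties.WithK using (unique∧set⇒bag)
open import Data.List.Relation.Binary.BagAndSetEquality using (∼bag⇒↭)
open import Data.List.Relation.Binary.Permutation.Propositional using (_↭_; ↭⇒↭ₛ′)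
import Data.List.Relation.Binary.Permutation.Propositional.Properties as ↭
open import Data.List.Relation.Binary.Permutation.Setoid.Properties using (foldr-commMonoid)
import Data.List.Relation.Unary.All as All
import Data.List.Relation.Unary.All.Properties as All
open import Data.List.Relation.Unary.AllPairs using ([]; _∷_)
open import Data.List.Relation.Unary.Any using (here; there)
open import Data.List.Relation.Unary.Unique.Propositional using (Unique)
import Data.List.Relation.Unary.Unique.Propositional.Properties as Unique
open import Data.Maybe using (Maybe; just; nothing; maybe; fromMaybe)
import Data.Maybe as Maybe
open import Data.Maybe.Properties using (just-injective)
open import Data.Nat using (ℕ; zero; suc; s≤s; z≤n; z<s; s<s; s<s⁻¹; _≡ᵇ_)
open import Data.Nat.Properties using (+-0-commutativeMonoid; ≡ᵇ⇒≡; ≡⇒≡ᵇ; <ᵇ⇒<; <⇒<ᵇ)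
import Data.Nat.Properties as ℕₚ
open import Data.Product using (_×_; _,_; proj₁; proj₂; swap; map₂; ∃; ∃-syntax)
open import Data.Sum using (_⊎_; inj₁; inj₂)
open import Data.Unit using (tt)
import Data.Vec as Vec
open import Data.Vec.Properties using (∷-injective; lookup∘tabulate; tabulate∘lookup; tabulate-cong)
open import Function using (_∘_; id; _⇔_; mk⇔; Equivalence)
open import Function.Properties.Equivalence using () renaming (trans to ⇔-trans)
open import Relation.Binary using (tri<; tri≈; tri>)
open import Relation.Binary.PropositionalEquality
  using (module ≡-Reasoning; _≡_; _≢_; refl; sym; trans; cong; cong₂; subst; _≗_)
import Relation.Binary.Reasoning.Setoid as ≈-Reasoning
open import Relation.Nullary using (¬_)
open import Relation.Nullary.Decidable using (isYes; toWitness; fromWitness; T?)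
open import Algebra.Properties.CommutativeMonoid.Sum +-0-commutativeMonoid
  using (sum-syntax; ∑-comm; sum-cong-≗)

-- Counting and searching over Fin

T⇒≡ : ∀ {b} → T b → b ≡ true
T⇒≡ = Equivalence.to T-≡

≡⇒T : ∀ {b} → b ≡ true → T b
≡⇒T = Equivalence.from T-≡

¬T⇒≡false : ∀ {b} → ¬ T b → b ≡ false
¬T⇒≡false {false} _  = refl
¬T⇒≡false {true}  ¬t = ⊥-elim (¬t tt)

T-injective : ∀ {a b} → T a ⇔ T b → a ≡ b
T-injective {false} {false} _ = refl
T-injective {false} {true}  e = ⊥-elim (Equivalence.from e tt)
T-injective {true}  {false} e = ⊥-elim (Equivalence.to e tt)
T-injective {true}  {true}  _ = refl

indicator : Bool → ℕ
indicator b = if b then 1 else 0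

count : ∀ {m} → (Fin m → Bool) → ℕ
count {m} p = ∑[ i < m ] indicator (p i)

count-cong : ∀ {m} {p q : Fin m → Bool} → p ≗ q → count p ≡ count q
count-cong p≗q = sum-cong-≗ (cong indicator ∘ p≗q)

count≡0 : ∀ {m} (p : Fin m → Bool) → (∀ x → ¬ T (p x)) → count p ≡ 0
count≡0 {zero} p none = refl
count≡0 {suc m} p none with p zero | none zero
... | true  | ¬pz = ⊥-elim (¬pz tt)
... | false | _   = count≡0 (p ∘ suc) (none ∘ suc)

count≡0⁻ : ∀ {m} (p : Fin m → Bool) → count p ≡ 0 → ∀ x → ¬ T (p x)
count≡0⁻ {suc m} p eq x px with p zero in pz
count≡0⁻ {suc m} p () x px | true
count≡0⁻ {suc m} p eq zero px | false = subst T pz px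
count≡0⁻ {suc m} p eq (suc x) px | false = count≡0⁻ (p ∘ suc) eq x px

count≡1 : ∀ {m} (p : Fin m → Bool) {a} → T (p a) → (∀ {x} → T (p x) → x ≡ a) → count p ≡ 1
count≡1 p {zero} pa uniq rewrite T⇒≡ pa =
  cong suc (count≡0 (p ∘ suc) λ x px → 0≢1+n (sym (uniq px)))
count≡1 p {suc a} pa uniq with p zero in pz
... | true  = ⊥-elim (0≢1+n (uniq (≡⇒T pz)))
... | false = count≡1 (p ∘ suc) pa (suc-injective ∘ uniq)

count≡1⁻ : ∀ {m} (p : Fin m → Bool) → count p ≡ 1 → ∃[ a ] T (p a) × (∀ {x} → T (p x) → x ≡ a)
count≡1⁻ {suc m} p eq with p zero in pz
... | true  = zero , ≡⇒T pz , λ {x} → only-zero x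
  where
  only-zero : ∀ x → T (p x) → x ≡ zero
  only-zero zero    _  = refl
  only-zero (suc x) px = ⊥-elim (count≡0⁻ (p ∘ suc) (ℕₚ.suc-injective eq) x px)
... | false with count≡1⁻ (p ∘ suc) eq
...   | a , pa , uniq = suc a , pa , only-suc-a
  where
  only-suc-a : ∀ {x} → T (p x) → x ≡ suc a
  only-suc-a {zero}  px = ⊥-elim (subst T pz px)
  only-suc-a {suc x} px = cong suc (uniq px)

indicator≡count : ∀ {m b} (p : Fin m → Bool) → (∀ {x y} → T (p x) → T (p y) → x ≡ y) →
                  (T b ⇔ (∃[ x ] T (p x))) → indicator b ≡ count p
indicator≡count {b = true} p unique b⇔ with Equivalence.to b⇔ tt
... | a , pa = sym (count≡1 p pa (λ px → unique px pa))
indicator≡count {b = false} p unique b⇔ = sym (count≡0 p λ x px → Equivalence.from b⇔ (x , px))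

count-matching : ∀ {m n} (R : Fin m → Fin n → Bool) {P : Fin m → Bool} {Q : Fin n → Bool} →
  (∀ {i j j′} → T (R i j) → T (R i j′) → j ≡ j′) →
  (∀ {i i′ j} → T (R i j) → T (R i′ j) → i ≡ i′) →
  (∀ i → T (P i) ⇔ (∃[ j ] T (R i j))) →
  (∀ j → T (Q j) ⇔ (∃[ i ] T (R i j))) →
  count P ≡ count Q
count-matching {m} {n} R {P} {Q} functional injective P⇔ Q⇔ = begin
  count P                         ≡⟨ sum-cong-≗ (λ i → indicator≡count (R i) functional (P⇔ i)) ⟩
  ∑[ i < m ] count (R i)          ≡⟨ ∑-comm (λ i j → indicator (R i j)) ⟩
  ∑[ j < n ] count (λ i → R i j)  ≡⟨ sum-cong-≗ (λ j → indicator≡count (λ i → R i j) injective (Q⇔ j)) ⟨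
  count Q                         ∎
  where open ≡-Reasoning

first : ∀ {m} → (Fin m → Bool) → Maybe (Fin m)
first {zero}  p = nothing
first {suc m} p = if p zero then just zero else Maybe.map suc (first (p ∘ suc))

IsFirst : ∀ {m} → (Fin m → Bool) → Fin m → Set
IsFirst p x = T (p x) × (∀ {y} → y < x → ¬ T (p y))

first-sound : ∀ {m} (p : Fin m → Bool) {x} → first p ≡ just x → IsFirst p x
first-sound {suc m} p eq with p zero in pz
first-sound {suc m} p refl | true = ≡⇒T pz , λ ()
... | false with first (p ∘ suc) in eq′
first-sound {suc m} p refl | false | just y with first-sound (p ∘ suc) eq′
... | py , minimal = py , below
  where
  below : ∀ {y′} → y′ < suc y → ¬ T (p y′)
  below {zero}   _           = subst T pz
  below {suc y′} (s≤s y′<y) = minimal y′<y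

first-complete : ∀ {m} (p : Fin m → Bool) {x} → IsFirst p x → first p ≡ just x
first-complete {suc m} p {zero} (px , _) rewrite T⇒≡ px = refl
first-complete {suc m} p {suc x} (px , minimal) with p zero in pz
... | true  = ⊥-elim (minimal (s≤s z≤n) (≡⇒T pz))
... | false rewrite first-complete (p ∘ suc) (px , minimal ∘ s≤s) = refl

first≡nothing : ∀ {m} (p : Fin m → Bool) → first p ≡ nothing → ∀ x → ¬ T (p x)
first≡nothing {suc m} p eq x px with p zero in pz
first≡nothing {suc m} p () x px | true
... | false with first (p ∘ suc) in eq′
first≡nothing {suc m} p refl zero    px | false | nothing = subst T pz px
first≡nothing {suc m} p refl (suc x) px | false | nothing = first≡nothing (p ∘ suc) eq′ x px

IsFirst-exists : ∀ {m} (p : Fin m → Bool) {x} → T (p x) → ∃ (IsFirst p)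
IsFirst-exists p {x} px with first p in eq
... | just y  = y , first-sound p eq
... | nothing = ⊥-elim (first≡nothing p eq x px)

IsFirst-unique : ∀ {m} {p : Fin m → Bool} {x y} → IsFirst p x → IsFirst p y → x ≡ y
IsFirst-unique {p = p} fx fy = just-injective (trans (sym (first-complete p fx)) (first-complete p fy))

IsFirst-cong : ∀ {m} {p q : Fin m → Bool} {x} → p ≗ q → IsFirst p x → IsFirst q x
IsFirst-cong {x = x} p≗q (px , minimal) =
  subst T (p≗q x) px , λ {y} y<x qy → minimal y<x (subst T (sym (p≗q y)) qy)

first-cong : ∀ {m} {p q : Fin m → Bool} → p ≗ q → first p ≡ first q
first-cong {zero}  p≗q = refl
first-cong {suc m} p≗q =
  cong₂ (λ b r → if b then just zero else Maybe.map suc r) (p≗q zero) (first-cong (p≗q ∘ suc))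

none⇒first≡nothing : ∀ {m} (p : Fin m → Bool) → (∀ x → ¬ T (p x)) → first p ≡ nothing
none⇒first≡nothing p none with first p in eq
... | just x  = ⊥-elim (none x (proj₁ (first-sound p eq)))
... | nothing = refl

infix 4 _==_
_==_ : ∀ {m} → Fin m → Fin m → Bool
a == b = isYes (a ≟ b)

firstIs : ∀ {m} → (Fin m → Bool) → Fin m → Bool
firstIs p x = maybe (_== x) false (first p)

T-firstIs : ∀ {m} (p : Fin m → Bool) {x} → T (firstIs p x) ⇔ IsFirst p x
T-firstIs p {x} with first p in eq
... | just y  = mk⇔ (λ y≡x → subst (IsFirst p) (toWitness y≡x) (first-sound p eq))
                    (λ fx → fromWitness (just-injective (trans (sym eq) (first-complete p fx))))
... | nothing = mk⇔ (λ ()) (λ fx → first≡nothing p eq x (proj₁ fx))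

count≡1⇒first : ∀ {m} (p : Fin (suc m) → Bool) → count p ≡ 1 → ∀ x → p x ≡ (fromMaybe zero (first p) == x)
count≡1⇒first p one x with count≡1⁻ p one
... | a , pa , unique rewrite first-complete p (pa , λ y<a py → <-irrefl (unique py) y<a) =
  T-injective (mk⇔ (λ px → fromWitness (sym (unique px))) (λ a≡x → subst (T ∘ p) (toWitness a≡x) pa))

first-== : ∀ {m} (a : Fin m) → first (a ==_) ≡ just a
first-== a = first-complete (a ==_) (fromWitness refl , λ y<a a≡y → <-irrefl (sym (toWitness a≡y)) y<a)

T-anyᵇ-tabulate : ∀ {A : Set} {m} (p : A → Bool) (g : Fin m → A) →
                  T (anyᵇ p (tabulate g)) ⇔ (∃[ x ] T (p (g x)))
T-anyᵇ-tabulate {m = zero}  p g = mk⇔ (λ ()) (λ ())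
T-anyᵇ-tabulate {m = suc m} p g = mk⇔ to from
  where
  ih = T-anyᵇ-tabulate p (g ∘ suc)
  to : T (p (g zero) ∨ anyᵇ p (tabulate (g ∘ suc))) → ∃[ x ] T (p (g x))
  to t with Equivalence.to T-∨ t
  ... | inj₁ pz = zero , pz
  ... | inj₂ ps = let x , px = Equivalence.to ih ps in suc x , px
  from : ∃[ x ] T (p (g x)) → T (p (g zero) ∨ anyᵇ p (tabulate (g ∘ suc)))
  from (zero  , px) = Equivalence.from T-∨ (inj₁ px)
  from (suc x , px) = Equivalence.from T-∨ (inj₂ (Equivalence.from ih (x , px)))

T-allᵇ-tabulate : ∀ {A : Set} {m} (p : A → Bool) (g : Fin m → A) →
                  T (allᵇ p (tabulate g)) ⇔ (∀ x → T (p (g x)))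
T-allᵇ-tabulate {m = zero}  p g = mk⇔ (λ _ ()) (λ _ → tt)
T-allᵇ-tabulate {m = suc m} p g = mk⇔
  (λ t → let pz , ps = Equivalence.to T-∧ t in λ where
     zero    → pz
     (suc x) → Equivalence.to (T-allᵇ-tabulate p (g ∘ suc)) ps x)
  (λ all → Equivalence.from T-∧ (all zero , Equivalence.from (T-allᵇ-tabulate p (g ∘ suc)) (all ∘ suc)))

anyᵇ-tabulate-cong : ∀ {A B : Set} {m} {p : A → Bool} {q : B → Bool} {g : Fin m → A} {h : Fin m → B} →
                     (∀ x → p (g x) ≡ q (h x)) → anyᵇ p (tabulate g) ≡ anyᵇ q (tabulate h)
anyᵇ-tabulate-cong {m = zero}  eq = refl
anyᵇ-tabulate-cong {m = suc m} eq = cong₂ _∨_ (eq zero) (anyᵇ-tabulate-cong (eq ∘ suc))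

countᵇ-tabulate : ∀ {A : Set} {m} (p : A → Bool) (g : Fin m → A) → countᵇ p (tabulate g) ≡ count (p ∘ g)
countᵇ-tabulate {m = zero}  p g = refl
countᵇ-tabulate {m = suc m} p g with p (g zero)
... | true  = cong suc (countᵇ-tabulate p (g ∘ suc))
... | false = countᵇ-tabulate p (g ∘ suc)

anyᵇ-allFin-cong : ∀ {m} {p q : Fin m → Bool} → p ≗ q → anyᵇ p (allFin m) ≡ anyᵇ q (allFin m)
anyᵇ-allFin-cong = anyᵇ-tabulate-cong

anyᵇ-allFin-suc : ∀ {m} (p : Fin (suc m) → Bool) →
                  anyᵇ p (allFin (suc m)) ≡ p zero ∨ anyᵇ (p ∘ suc) (allFin m)
anyᵇ-allFin-suc p = cong (p zero ∨_) (anyᵇ-tabulate-cong {p = p} {q = p ∘ suc} {g = suc} {h = id} λ _ → refl)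

T-⇒ᵇ : ∀ {a b} → T (a ⇒ᵇ b) ⇔ (T a → T b)
T-⇒ᵇ {true}  = mk⇔ (λ b _ → b) (λ f → f tt)
T-⇒ᵇ {false} = mk⇔ (λ _ ()) (λ _ → tt)

-- Arrow configurations

private variable n k : ℕ

-- r i is the column of the ← in row suc i and c j the row of the ↓ in column suc j (row 0 is the
-- bottom row, column 0 the leftmost one). Precedes r c: a ← lies strictly left of any ↓ of its
-- row; Precedes c r: a ↓ lies strictly below any ← of its column.
Precedes : (Fin n → Fin (suc k)) → (Fin k → Fin (suc n)) → Set
Precedes r c = ∀ {i j} → c j ≡ suc i → r i < suc j

Compatible : (Fin n → Fin (suc k)) → (Fin k → Fin (suc n)) → Set
Compatible r c = Precedes r c × Precedes c r

-- Corner c r j i is the mirrored notion: the ↓ of column suc j is in the bottom row and row suc i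
-- holds the lowest ← of that column.
record Corner (r : Fin n → Fin (suc k)) (c : Fin k → Fin (suc n)) (i : Fin n) (j : Fin k) : Set where
  constructor mkCorner
  field
    left-at-edge  : r i ≡ zero
    leftmost-down : IsFirst (λ j → c j == suc i) j

  down-row : c j ≡ suc i
  down-row = toWitness (proj₁ leftmost-down)

open Corner

isCorner : (Fin n → Fin (suc k)) → (Fin k → Fin (suc n)) → Fin n → Fin k → Bool
isCorner r c i j = (r i == zero) ∧ firstIs (λ j → c j == suc i) j

T-isCorner : ∀ (r : Fin n → Fin (suc k)) c {i j} → T (isCorner r c i j) ⇔ Corner r c i j
T-isCorner r c {i} {j} = mk⇔
  (λ t → let ri , fi = Equivalence.to T-∧ t in mkCorner (toWitness ri) (Equivalence.to (T-firstIs _) fi))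
  (λ (mkCorner ri fi) → Equivalence.from T-∧ (fromWitness ri , Equivalence.from (T-firstIs _) fi))

Corner-cong : ∀ {r r′ : Fin n → Fin (suc k)} {c c′ i j} →
              r ≗ r′ → c ≗ c′ → Corner r c i j → Corner r′ c′ i j
Corner-cong {i = i} r≗r′ c≗c′ (mkCorner ri fj) =
  mkCorner (trans (sym (r≗r′ i)) ri) (IsFirst-cong (λ j → cong (_== suc i) (c≗c′ j)) fj)

move : Fin (suc k) → Maybe (Fin k) → (Fin k → Bool) → Fin (suc k)
move zero    leftmost mirrored = maybe suc zero leftmost
move (suc j) leftmost mirrored = if mirrored j then zero else suc j

move≡suc : ∀ a {m t} {j : Fin k} → move a m t ≡ suc j → (a ≡ zero × m ≡ just j) ⊎ (a ≡ suc j × ¬ T (t j))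
move≡suc zero {just j} refl = inj₁ (refl , refl)
move≡suc (suc j) {t = t} eq with t j in tj
move≡suc (suc j) {t = t} refl | false = inj₂ (refl , subst T tj)

move≡zero : ∀ a {m t} → move {k} a m t ≡ zero → (a ≡ zero × m ≡ nothing) ⊎ ∃[ j ] (a ≡ suc j × T (t j))
move≡zero zero {nothing} refl = inj₁ (refl , refl)
move≡zero (suc j) {t = t} eq with t j in tj
... | true = inj₂ (j , refl , ≡⇒T tj)

-- The new column of the ← of row suc i: a corner moves it onto the column of the corner, a
-- mirrored corner moves it back to the leftmost column.
switch : (Fin n → Fin (suc k)) → (Fin k → Fin (suc n)) → Fin n → Fin (suc k)
switch r c i = move (r i) (first (λ j → c j == suc i)) (λ j → isCorner c r j i)

module _ (r : Fin n → Fin (suc k)) (c : Fin k → Fin (suc n)) {i : Fin n} where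

  switch-corner : ∀ {j} → Corner r c i j → switch r c i ≡ suc j
  switch-corner (mkCorner ri fj) rewrite ri | first-complete _ fj = refl

  switch-mirror : ∀ {j} → Corner c r j i → switch r c i ≡ zero
  switch-mirror {j} cor rewrite down-row cor | T⇒≡ (Equivalence.from (T-isCorner c r) cor) = refl

  switch-empty : r i ≡ zero → (∀ j → c j ≢ suc i) → switch r c i ≡ zero
  switch-empty ri none
    rewrite ri | none⇒first≡nothing (λ j → c j == suc i) (λ j → none j ∘ toWitness) = refl

  switch-fixed : ∀ {j} → r i ≡ suc j → ¬ Corner c r j i → switch r c i ≡ suc j
  switch-fixed {j} ri ¬cor with isCorner c r j i in cor
  ... | true  = ⊥-elim (¬cor (Equivalence.to (T-isCorner c r) (≡⇒T cor)))
  ... | false rewrite ri | cor = refl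

  switch≡suc : ∀ {j} → switch r c i ≡ suc j → Corner r c i j ⊎ (r i ≡ suc j × ¬ Corner c r j i)
  switch≡suc eq with move≡suc (r i) eq
  ... | inj₁ (ri , fi)  = inj₁ (mkCorner ri (first-sound _ fi))
  ... | inj₂ (ri , ¬cor) = inj₂ (ri , ¬cor ∘ Equivalence.from (T-isCorner c r))

  switch≡zero : switch r c i ≡ zero → (r i ≡ zero × ∀ j → c j ≢ suc i) ⊎ ∃[ j ] Corner c r j i
  switch≡zero eq with move≡zero (r i) eq
  ... | inj₁ (ri , fi)      = inj₁ (ri , λ j cj → first≡nothing _ fi j (fromWitness cj))
  ... | inj₂ (j , ri , cor) = inj₂ (j , Equivalence.to (T-isCorner c r) cor)

move-cong : ∀ a m {t t′ : Fin k → Bool} → t ≗ t′ → move a m t ≡ move a m t′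
move-cong zero    m t≗t′ = refl
move-cong (suc j) m t≗t′ = cong (λ b → if b then zero else suc j) (t≗t′ j)

isCorner-cong : ∀ {r r′ : Fin n → Fin (suc k)} {c c′} →
                r ≗ r′ → c ≗ c′ → ∀ i j → isCorner r c i j ≡ isCorner r′ c′ i j
isCorner-cong r≗r′ c≗c′ i j =
  cong₂ _∧_ (cong (_== zero) (r≗r′ i)) (cong (maybe (_== j) false) (first-cong λ j → cong (_== suc i) (c≗c′ j)))

switch-cong : ∀ {r r′ : Fin n → Fin (suc k)} {c c′} → r ≗ r′ → c ≗ c′ → switch r c ≗ switch r′ c′
switch-cong {r′ = r′} r≗r′ c≗c′ i =
  trans (cong₂ (λ a m → move a m _) (r≗r′ i) (first-cong λ j → cong (_== suc i) (c≗c′ j)))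
        (move-cong (r′ i) _ λ j → isCorner-cong c≗c′ r≗r′ j i)

data RowView (r : Fin n → Fin (suc k)) (c : Fin k → Fin (suc n)) (i : Fin n) : Set where
  corner : ∀ {j} → Corner r c i j → RowView r c i
  mirror : ∀ {j} → Corner c r j i → RowView r c i
  empty  : r i ≡ zero → (∀ j → c j ≢ suc i) → RowView r c i
  fixed  : ∀ {j} → r i ≡ suc j → ¬ Corner c r j i → RowView r c i

rowView : ∀ (r : Fin n → Fin (suc k)) c i → RowView r c i
rowView r c i with switch r c i in sw
... | zero with switch≡zero r c sw
...   | inj₁ (ri , none) = empty ri none
...   | inj₂ (_ , cor)   = mirror cor
rowView r c i | suc j with switch≡suc r c sw
...   | inj₁ cor         = corner cor
...   | inj₂ (ri , ¬cor) = fixed ri ¬cor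

corner-transfer : ∀ {r : Fin n → Fin (suc k)} {c} → Precedes c r →
                  ∀ {i j} → Corner r c i j → Corner (switch c r) (switch r c) j i
corner-transfer {r = r} {c} c≺r {i} {j} cor =
  mkCorner (switch-mirror c r cor) (fromWitness (switch-corner r c cor) , lowest)
  where
  lowest : ∀ {i′} → i′ < i → ¬ T (switch r c i′ == suc j)
  lowest i′<i t with switch≡suc r c (toWitness t)
  ... | inj₁ cor′       = <-irrefl (suc-injective (trans (sym (down-row cor′)) (down-row cor))) i′<i
  ... | inj₂ (ri′ , _) = <-asym i′<i (s<s⁻¹ (subst (_< suc _) (down-row cor) (c≺r ri′)))

leftmost-< : ∀ {r : Fin n → Fin (suc k)} {c i j j′} →
             Corner r c i j′ → c j ≡ suc i → ¬ Corner r c i j → j′ < j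
leftmost-< {j = j} {j′} cor′ cj ¬cor with <-cmp j′ j
... | tri< lt _ _   = lt
... | tri≈ _ refl _ = ⊥-elim (¬cor cor′)
... | tri> _ _ gt   = ⊥-elim (proj₂ (leftmost-down cor′) gt (fromWitness cj))

switch-precedes : ∀ {r : Fin n → Fin (suc k)} {c} → Compatible r c → Precedes (switch r c) (switch c r)
switch-precedes {r = r} {c} (r≺c , _) {i} {j} eq with switch≡suc c r eq
... | inj₁ cor = subst (_< suc j) (sym (switch-mirror r c cor)) z<s
... | inj₂ (cj , ¬cor) with switch r c i in sw
...   | zero   = z<s
...   | suc j′ with switch≡suc r c sw
...     | inj₁ cor′     = s<s (leftmost-< cor′ cj ¬cor)
...     | inj₂ (ri , _) = subst (_< suc j) ri (r≺c cj)

switch-compatible : ∀ {r : Fin n → Fin (suc k)} {c} → Compatible r c → Compatible (switch r c) (switch c r)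
switch-compatible compatible = switch-precedes compatible , switch-precedes (swap compatible)

switch-involutive : ∀ {r : Fin n → Fin (suc k)} {c} → Compatible r c →
                    ∀ i → switch (switch r c) (switch c r) i ≡ r i
switch-involutive {r = r} {c} (r≺c , c≺r) i with rowView r c i
... | corner cor = trans (switch-mirror (switch r c) (switch c r) (corner-transfer c≺r cor)) (sym (left-at-edge cor))
... | mirror cor = trans (switch-corner (switch r c) (switch c r) (corner-transfer r≺c cor)) (sym (down-row cor))
... | empty ri none = trans (switch-empty (switch r c) (switch c r) (switch-empty r c ri none) none′) (sym ri)
  where
  none′ : ∀ j → switch c r j ≢ suc i
  none′ j eq with switch≡suc c r eq
  ... | inj₁ cor      = 0≢1+n (trans (sym ri) (down-row cor))
  ... | inj₂ (cj , _) = none j cj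
... | fixed {j} ri ¬cor = trans (switch-fixed (switch r c) (switch c r) (switch-fixed r c ri ¬cor) ¬cor′) (sym ri)
  where
  ¬cor′ : ¬ Corner (switch c r) (switch r c) j i
  ¬cor′ (mkCorner cj (_ , lowest)) with switch≡zero c r cj
  ... | inj₁ (_ , none) = none i ri
  ... | inj₂ (i₁ , cor) =
    lowest (s<s⁻¹ (subst (_< suc i) (down-row cor) (c≺r ri))) (fromWitness (switch-corner r c cor))

hasCorner : (Fin n → Fin (suc k)) → (Fin k → Fin (suc n)) → Fin n → Bool
hasCorner {k = k} r c i = anyᵇ (λ j → c j == suc i) (allFin k) ∧ (r i == zero)

T-hasCorner : ∀ (r : Fin n → Fin (suc k)) c {i} → T (hasCorner r c i) ⇔ ∃ (Corner r c i)
T-hasCorner r c {i} = mk⇔ to from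
  where
  down? = λ j → c j == suc i
  to : T (hasCorner r c i) → ∃ (Corner r c i)
  to t with Equivalence.to (T-∧ {anyᵇ down? (allFin _)}) t
  ... | some , ri with Equivalence.to (T-anyᵇ-tabulate down? id) some
  ...   | _ , cj with IsFirst-exists (λ j → c j == suc i) cj
  ...     | j , fj = j , mkCorner (toWitness ri) fj
  from : ∃ (Corner r c i) → T (hasCorner r c i)
  from (j , cor) = Equivalence.from (T-∧ {anyᵇ down? (allFin _)})
    (Equivalence.from (T-anyᵇ-tabulate down? id) (j , proj₁ (leftmost-down cor)) , fromWitness (left-at-edge cor))

weight : (Fin n → Fin (suc k)) → (Fin k → Fin (suc n)) → ℕ
weight r c = count (hasCorner r c)

weight-switch : ∀ {r : Fin n → Fin (suc k)} {c} → Compatible r c → weight (switch r c) (switch c r) ≡ weight c r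
weight-switch {r = r} {c} compatible@(r≺c , _) =
  count-matching (λ i j → isCorner c r j i) functional injective row-corners column-corners
  where
  functional : ∀ {i j j′} → T (isCorner c r j i) → T (isCorner c r j′ i) → j ≡ j′
  functional t t′ = suc-injective (trans (sym (down-row (Equivalence.to (T-isCorner c r) t)))
                                         (down-row (Equivalence.to (T-isCorner c r) t′)))
  injective : ∀ {i i′ j} → T (isCorner c r j i) → T (isCorner c r j i′) → i ≡ i′
  injective t t′ = IsFirst-unique (leftmost-down (Equivalence.to (T-isCorner c r) t))
                                  (leftmost-down (Equivalence.to (T-isCorner c r) t′))
  switched⇒mirror : ∀ {i j} → Corner (switch r c) (switch c r) i j → Corner c r j i
  switched⇒mirror = Corner-cong (switch-involutive (swap compatible)) (switch-involutive compatible)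
                  ∘ corner-transfer (switch-precedes (swap compatible))
  row-corners : ∀ i → T (hasCorner (switch r c) (switch c r) i) ⇔ (∃[ j ] T (isCorner c r j i))
  row-corners i = ⇔-trans (T-hasCorner (switch r c) (switch c r))
    (mk⇔ (map₂ (Equivalence.from (T-isCorner c r) ∘ switched⇒mirror))
         (map₂ (corner-transfer r≺c ∘ Equivalence.to (T-isCorner c r))))
  column-corners : ∀ j → T (hasCorner c r j) ⇔ (∃[ i ] T (isCorner c r j i))
  column-corners j = ⇔-trans (T-hasCorner c r)
    (mk⇔ (map₂ (Equivalence.from (T-isCorner c r))) (map₂ (Equivalence.to (T-isCorner c r))))

-- Fillings

leftAt : (Fin n → Fin (suc k)) → Fin (suc n) → Fin (suc k) → Bool
leftAt r zero    j = false
leftAt r (suc i) j = r i == j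

arrowAt : (Fin n → Fin (suc k)) → (Fin k → Fin (suc n)) → Fin (suc n) → Fin (suc k) → Arrow
arrowAt r c i j = if leftAt r i j then left else if leftAt c j i then down else blank

encode : (Fin n → Fin (suc k)) → (Fin k → Fin (suc n)) → Filling n k
encode r c = Vec.tabulate λ i → Vec.tabulate λ j → arrowAt r c i j

cell-encode : ∀ (r : Fin n → Fin (suc k)) c i j → cell (encode r c) i j ≡ arrowAt r c i j
cell-encode r c i j = trans (cong (λ row → Vec.lookup row j) (lookup∘tabulate (λ i → Vec.tabulate (arrowAt r c i)) i))
                            (lookup∘tabulate (arrowAt r c i) j)

encode-cong : ∀ {r r′ : Fin n → Fin (suc k)} {c c′} → r ≗ r′ → c ≗ c′ → encode r c ≡ encode r′ c′
encode-cong {r = r} {r′} {c} {c′} r≗r′ c≗c′ = tabulate-cong λ i → tabulate-cong λ j →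
  cong₂ (λ l d → if l then left else if d then down else blank) (leftAt-cong r≗r′ i j) (leftAt-cong c≗c′ j i)
  where
  leftAt-cong : ∀ {n k} {r r′ : Fin n → Fin (suc k)} → r ≗ r′ → ∀ i j → leftAt r i j ≡ leftAt r′ i j
  leftAt-cong r≗r′ zero    j = refl
  leftAt-cong r≗r′ (suc i) j = cong (_== j) (r≗r′ i)

leftAt-clear : ∀ {r : Fin n → Fin (suc k)} {c i j j′} → Precedes r c →
             T (leftAt r i j) → j′ < j → ¬ T (leftAt r i j′) × ¬ T (leftAt c j′ i)
leftAt-clear {c = c} {i = suc i} {j} {j′} r≺c rij j′<j =
  (λ rij′ → <-irrefl (trans (sym (toWitness rij′)) (toWitness rij)) j′<j) , no-down j′ j′<j
  where
  no-down : ∀ j′ → j′ < j → ¬ T (leftAt c j′ (suc i))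
  no-down (suc j″) j′<j cj = <-asym j′<j (subst (_< suc j″) (toWitness rij) (r≺c (toWitness cj)))

no-clash : ∀ {r : Fin n → Fin (suc k)} {c i j} → Precedes r c → T (leftAt r i j) → ¬ T (leftAt c j i)
no-clash {i = suc i} {suc j} r≺c rij cji = <-irrefl (toWitness rij) (r≺c (toWitness cji))

isLeft-arrowAt : ∀ (r : Fin n → Fin (suc k)) c i j → isLeft (arrowAt r c i j) ≡ leftAt r i j
isLeft-arrowAt r c i j with leftAt r i j | leftAt c j i
... | true  | _     = refl
... | false | true  = refl
... | false | false = refl

isDown-arrowAt : ∀ {r : Fin n → Fin (suc k)} {c} → Precedes r c → ∀ i j → isDown (arrowAt r c i j) ≡ leftAt c j i
isDown-arrowAt {r = r} {c} r≺c i j with leftAt r i j in rij | leftAt c j i in cji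
... | true  | true  = ⊥-elim (no-clash {i = i} {j} r≺c (≡⇒T rij) (≡⇒T cji))
... | true  | false = refl
... | false | true  = refl
... | false | false = refl

isBlank-arrowAt : ∀ (r : Fin n → Fin (suc k)) c i j →
                  ¬ T (leftAt r i j) → ¬ T (leftAt c j i) → T (isBlank (arrowAt r c i j))
isBlank-arrowAt r c i j ¬l ¬d with leftAt r i j | leftAt c j i
... | true  | _     = ¬l tt
... | false | true  = ¬d tt
... | false | false = tt

isLeft-encode : ∀ (r : Fin n → Fin (suc k)) c i j → isLeft (cell (encode r c) i j) ≡ leftAt r i j
isLeft-encode r c i j = trans (cong isLeft (cell-encode r c i j)) (isLeft-arrowAt r c i j)

isDown-encode : ∀ {r : Fin n → Fin (suc k)} {c} → Precedes r c → ∀ i j → isDown (cell (encode r c) i j) ≡ leftAt c j i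
isDown-encode {r = r} {c} r≺c i j = trans (cong isDown (cell-encode r c i j)) (isDown-arrowAt r≺c i j)

record PackedAltTableau (a : Fin (suc n) → Fin (suc k) → Arrow) : Set where
  field
    left-clear             : ∀ {i j j′} → T (isLeft (a i j)) → j′ < j → T (isBlank (a i j′))
    down-clear             : ∀ {i i′ j} → T (isDown (a i j)) → i′ < i → T (isBlank (a i′ j))
    no-left-in-bottom-row  : ∀ j → ¬ T (isLeft (a zero j))
    one-left-per-row       : ∀ i → count (λ j → isLeft (a (suc i) j)) ≡ 1
    no-down-in-left-column : ∀ i → ¬ T (isDown (a i zero))
    one-down-per-column    : ∀ j → count (λ i → isDown (a i (suc j))) ≡ 1

PackedAltTableau-resp : ∀ {a b : Fin (suc n) → Fin (suc k) → Arrow} → (∀ i j → a i j ≡ b i j) →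
                        PackedAltTableau a → PackedAltTableau b
PackedAltTableau-resp {a = a} {b} a≗b packed = record
  { left-clear             = λ l lt → to isBlank (left-clear (from isLeft l) lt)
  ; down-clear             = λ d lt → to isBlank (down-clear (from isDown d) lt)
  ; no-left-in-bottom-row  = λ j → no-left-in-bottom-row j ∘ from isLeft
  ; one-left-per-row       = λ i → trans (count-cong λ j → cong isLeft (sym (a≗b (suc i) j))) (one-left-per-row i)
  ; no-down-in-left-column = λ i → no-down-in-left-column i ∘ from isDown
  ; one-down-per-column    = λ j → trans (count-cong λ i → cong isDown (sym (a≗b i (suc j)))) (one-down-per-column j)
  }
  where
  open PackedAltTableau packed
  to : ∀ (test : Arrow → Bool) {i j} → T (test (a i j)) → T (test (b i j))
  to test {i} {j} = subst (T ∘ test) (a≗b i j)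
  from : ∀ (test : Arrow → Bool) {i j} → T (test (b i j)) → T (test (a i j))
  from test {i} {j} = subst (T ∘ test) (sym (a≗b i j))

arrowAt-packed : ∀ {r : Fin n → Fin (suc k)} {c} → Compatible r c → PackedAltTableau (arrowAt r c)
arrowAt-packed {r = r} {c} (r≺c , c≺r) = record
  { left-clear             = λ {i} {j} {j′} l lt →
      let ¬l , ¬d = leftAt-clear {i = i} {j} {j′} r≺c (subst T (isLeft-arrowAt r c i j) l) lt
      in isBlank-arrowAt r c i j′ ¬l ¬d
  ; down-clear             = λ {i} {i′} {j} d lt →
      let ¬d , ¬l = leftAt-clear {i = j} {i} {i′} c≺r (subst T (isDown-arrowAt r≺c i j) d) lt
      in isBlank-arrowAt r c i′ j ¬l ¬d
  ; no-left-in-bottom-row  = λ j → subst T (isLeft-arrowAt r c zero j)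
  ; one-left-per-row       = λ i →
      trans (count-cong (isLeft-arrowAt r c (suc i))) (count≡1 (r i ==_) (fromWitness refl) (sym ∘ toWitness))
  ; no-down-in-left-column = λ i → subst T (isDown-arrowAt r≺c i zero)
  ; one-down-per-column    = λ j →
      trans (count-cong λ i → isDown-arrowAt r≺c i (suc j)) (count≡1 (c j ==_) (fromWitness refl) (sym ∘ toWitness))
  }

module _ (tab : Filling n k) where

  private
    all⁻ : ∀ {m} (p : Fin m → Bool) → T (allᵇ p (allFin m)) → ∀ x → T (p x)
    all⁻ p = Equivalence.to (T-allᵇ-tabulate p id)
    all⁺ : ∀ {m} (p : Fin m → Bool) → (∀ x → T (p x)) → T (allᵇ p (allFin m))
    all⁺ p = Equivalence.from (T-allᵇ-tabulate p id)
    ⇒ᵇ⁻ : ∀ {a b} → T (a ⇒ᵇ b) → T a → T b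
    ⇒ᵇ⁻ = Equivalence.to T-⇒ᵇ
    ⇒ᵇ⁺ : ∀ {a b} → (T a → T b) → T (a ⇒ᵇ b)
    ⇒ᵇ⁺ = Equivalence.from T-⇒ᵇ

  T-leftPointsEmpty : T (leftPointsEmpty tab) ⇔
    (∀ {i j j′} → T (isLeft (cell tab i j)) → j′ < j → T (isBlank (cell tab i j′)))
  T-leftPointsEmpty = mk⇔
    (λ t {i} {j} {j′} l j′<j → ⇒ᵇ⁻ (all⁻ _ (⇒ᵇ⁻ (all⁻ _ (all⁻ _ t i) j) l) j′) (<⇒<ᵇ j′<j))
    (λ clear → all⁺ _ λ i → all⁺ _ λ j → ⇒ᵇ⁺ λ l → all⁺ _ λ j′ → ⇒ᵇ⁺ λ j′<j →
       clear {i} {j} {j′} l (<ᵇ⇒< _ _ j′<j))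

  T-downPointsEmpty : T (downPointsEmpty tab) ⇔
    (∀ {i i′ j} → T (isDown (cell tab i j)) → i′ < i → T (isBlank (cell tab i′ j)))
  T-downPointsEmpty = mk⇔
    (λ t {i} {i′} {j} d i′<i → ⇒ᵇ⁻ (all⁻ _ (⇒ᵇ⁻ (all⁻ _ (all⁻ _ t i) j) d) i′) (<⇒<ᵇ i′<i))
    (λ clear → all⁺ _ λ i → all⁺ _ λ j → ⇒ᵇ⁺ λ d → all⁺ _ λ i′ → ⇒ᵇ⁺ λ i′<i →
       clear {i} {i′} {j} d (<ᵇ⇒< _ _ i′<i))

  T-rowCondition : T (rowCondition tab) ⇔
    ((∀ j → ¬ T (isLeft (cell tab zero j))) × (∀ i → count (λ j → isLeft (cell tab (suc i) j)) ≡ 1))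
  T-rowCondition = mk⇔
    (λ t → count≡0⁻ _ (trans (sym (lefts zero)) (≡ᵇ⇒≡ _ 0 (all⁻ rowOK t zero))) ,
           λ i → trans (sym (lefts (suc i))) (≡ᵇ⇒≡ _ 1 (all⁻ rowOK t (suc i))))
    (λ (none , one) → all⁺ rowOK λ where
       zero    → ≡⇒≡ᵇ _ 0 (trans (lefts zero) (count≡0 _ none))
       (suc i) → ≡⇒≡ᵇ _ 1 (trans (lefts (suc i)) (one i)))
    where
    rowOK : Fin (suc n) → Bool
    rowOK i = if isZeroFin i then leftsInRow tab i ≡ᵇ 0 else leftsInRow tab i ≡ᵇ 1
    lefts : ∀ i → leftsInRow tab i ≡ count (λ j → isLeft (cell tab i j))
    lefts i = countᵇ-tabulate (λ j → isLeft (cell tab i j)) id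

  T-colCondition : T (colCondition tab) ⇔
    ((∀ i → ¬ T (isDown (cell tab i zero))) × (∀ j → count (λ i → isDown (cell tab i (suc j))) ≡ 1))
  T-colCondition = mk⇔
    (λ t → count≡0⁻ _ (trans (sym (downs zero)) (≡ᵇ⇒≡ _ 0 (all⁻ colOK t zero))) ,
           λ j → trans (sym (downs (suc j))) (≡ᵇ⇒≡ _ 1 (all⁻ colOK t (suc j))))
    (λ (none , one) → all⁺ colOK λ where
       zero    → ≡⇒≡ᵇ _ 0 (trans (downs zero) (count≡0 _ none))
       (suc j) → ≡⇒≡ᵇ _ 1 (trans (downs (suc j)) (one j)))
    where
    colOK : Fin (suc k) → Bool
    colOK j = if isZeroFin j then downsInCol tab j ≡ᵇ 0 else downsInCol tab j ≡ᵇ 1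
    downs : ∀ j → downsInCol tab j ≡ count (λ i → isDown (cell tab i j))
    downs j = countᵇ-tabulate (λ i → isDown (cell tab i j)) id

  T-isPackedAltTableau : T (isPackedAltTableau tab) ⇔ PackedAltTableau (cell tab)
  T-isPackedAltTableau = mk⇔ to from
    where
    to : T (isPackedAltTableau tab) → PackedAltTableau (cell tab)
    to t with Equivalence.to (T-∧ {leftPointsEmpty tab}) t
    ... | lp , rest with Equivalence.to (T-∧ {downPointsEmpty tab}) rest
    ... | dp , rest′ with Equivalence.to (T-∧ {rowCondition tab}) rest′
    ... | rc , cc = record
      { left-clear             = Equivalence.to T-leftPointsEmpty lp
      ; down-clear             = Equivalence.to T-downPointsEmpty dp
      ; no-left-in-bottom-row  = proj₁ (Equivalence.to T-rowCondition rc)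
      ; one-left-per-row       = proj₂ (Equivalence.to T-rowCondition rc)
      ; no-down-in-left-column = proj₁ (Equivalence.to T-colCondition cc)
      ; one-down-per-column    = proj₂ (Equivalence.to T-colCondition cc)
      }
    from : PackedAltTableau (cell tab) → T (isPackedAltTableau tab)
    from packed =
      Equivalence.from (T-∧ {leftPointsEmpty tab}) (Equivalence.from T-leftPointsEmpty left-clear ,
      Equivalence.from (T-∧ {downPointsEmpty tab}) (Equivalence.from T-downPointsEmpty down-clear ,
      Equivalence.from (T-∧ {rowCondition tab})
        (Equivalence.from T-rowCondition (no-left-in-bottom-row , one-left-per-row) ,
         Equivalence.from T-colCondition (no-down-in-left-column , one-down-per-column))))
      where open PackedAltTableau packed

-- The default zero is never used on a packed tableau, whose upper rows and right columns carry
-- exactly one arrow each.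
leftColumn : Filling n k → Fin n → Fin (suc k)
leftColumn tab i = fromMaybe zero (first λ j → isLeft (cell tab (suc i) j))

downRow : Filling n k → Fin k → Fin (suc n)
downRow tab j = fromMaybe zero (first λ i → isDown (cell tab i (suc j)))

leftColumn-encode : ∀ (r : Fin n → Fin (suc k)) c → leftColumn (encode r c) ≗ r
leftColumn-encode r c i = cong (fromMaybe zero) (trans (first-cong (isLeft-encode r c (suc i))) (first-== (r i)))

downRow-encode : ∀ {r : Fin n → Fin (suc k)} {c} → Precedes r c → downRow (encode r c) ≗ c
downRow-encode {c = c} r≺c j =
  cong (fromMaybe zero) (trans (first-cong λ i → isDown-encode r≺c i (suc j)) (first-== (c j)))

isLeft⇒¬isDown : ∀ {a} → T (isLeft a) → ¬ T (isDown a)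
isLeft⇒¬isDown {left} _ ()

isLeft⇒¬isBlank : ∀ {a} → T (isLeft a) → ¬ T (isBlank a)
isLeft⇒¬isBlank {left} _ ()

isDown⇒¬isBlank : ∀ {a} → T (isDown a) → ¬ T (isBlank a)
isDown⇒¬isBlank {down} _ ()

arrow-by-tests : ∀ a → a ≡ (if isLeft a then left else if isDown a then down else blank)
arrow-by-tests blank = refl
arrow-by-tests left  = refl
arrow-by-tests down  = refl

module Decode (tab : Filling n k) (packed : PackedAltTableau (cell tab)) where
  open PackedAltTableau packed

  r = leftColumn tab
  c = downRow tab

  isLeft-cell : ∀ i j → isLeft (cell tab i j) ≡ leftAt r i j
  isLeft-cell zero    j = ¬T⇒≡false (no-left-in-bottom-row j)
  isLeft-cell (suc i) j = count≡1⇒first (λ j → isLeft (cell tab (suc i) j)) (one-left-per-row i) j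

  isDown-cell : ∀ i j → isDown (cell tab i j) ≡ leftAt c j i
  isDown-cell i zero    = ¬T⇒≡false (no-down-in-left-column i)
  isDown-cell i (suc j) = count≡1⇒first (λ i → isDown (cell tab i (suc j))) (one-down-per-column j) i

  left-at : ∀ {i j} → T (leftAt r i j) → T (isLeft (cell tab i j))
  left-at {i} {j} = subst T (sym (isLeft-cell i j))

  down-at : ∀ {i j} → T (leftAt c j i) → T (isDown (cell tab i j))
  down-at {i} {j} = subst T (sym (isDown-cell i j))

  encode-decode : encode r c ≡ tab
  encode-decode = begin
    encode r c
      ≡⟨ tabulate-cong (λ i → tabulate-cong λ j → sym (cell-decode i j)) ⟩
    Vec.tabulate (λ i → Vec.tabulate (Vec.lookup (Vec.lookup tab i)))
      ≡⟨ tabulate-cong (λ i → tabulate∘lookup (Vec.lookup tab i)) ⟩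
    Vec.tabulate (Vec.lookup tab)
      ≡⟨ tabulate∘lookup tab ⟩
    tab ∎
    where
    open ≡-Reasoning
    cell-decode : ∀ i j → cell tab i j ≡ arrowAt r c i j
    cell-decode i j = trans (arrow-by-tests (cell tab i j))
      (cong₂ (λ l d → if l then left else if d then down else blank) (isLeft-cell i j) (isDown-cell i j))

  r≺c : Precedes r c
  r≺c {i} {j} cj with <-cmp (r i) (suc j)
  ... | tri< lt _ _ = lt
  ... | tri≈ _ eq _ = ⊥-elim (isLeft⇒¬isDown (left-at {suc i} (fromWitness eq)) (down-at (fromWitness cj)))
  ... | tri> _ _ gt = ⊥-elim (isDown⇒¬isBlank (down-at {suc i} (fromWitness cj))
                                              (left-clear (left-at {suc i} (fromWitness refl)) gt))

  c≺r : Precedes c r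
  c≺r {j} {i} ri with <-cmp (c j) (suc i)
  ... | tri< lt _ _ = lt
  ... | tri≈ _ eq _ = ⊥-elim (isLeft⇒¬isDown (left-at {suc i} (fromWitness ri)) (down-at {suc i} (fromWitness eq)))
  ... | tri> _ _ gt = ⊥-elim (isLeft⇒¬isBlank (left-at {suc i} (fromWitness ri))
                                              (down-clear (down-at {j = suc j} (fromWitness refl)) gt))

  compatible : Compatible r c
  compatible = r≺c , c≺r

shifted : ∀ {m} → (Fin m → Bool) → Fin (suc m) → Bool
shifted p zero    = false
shifted p (suc i) = p i

wDown-encode : ∀ {r : Fin n → Fin (suc k)} {c} → Precedes r c → wDown (encode r c) ≡ weight r c
wDown-encode {n = n} {k} {r} {c} r≺c = trans (countᵇ-tabulate counted id) (count-cong row)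
  where
  counted : Fin (suc n) → Bool
  counted i = anyᵇ (λ j → isDown (cell (encode r c) i j)) (allFin (suc k)) ∧ isLeft (cell (encode r c) i zero)
  row : ∀ i → counted i ≡ shifted (hasCorner r c) i
  row zero    = trans (cong₂ _∧_ refl (isLeft-encode r c zero zero)) (∧-zeroʳ _)
  row (suc i) = cong₂ _∧_
    (trans (anyᵇ-allFin-cong (isDown-encode r≺c (suc i))) (anyᵇ-allFin-suc (λ j → leftAt c j (suc i))))
    (isLeft-encode r c (suc i) zero)

wLeft-encode : ∀ {r : Fin n → Fin (suc k)} {c} → Precedes r c → wLeft (encode r c) ≡ weight c r
wLeft-encode {n = n} {k} {r} {c} r≺c = trans (countᵇ-tabulate counted id) (count-cong column)
  where
  counted : Fin (suc k) → Bool
  counted j = anyᵇ (λ i → isLeft (cell (encode r c) i j)) (allFin (suc n)) ∧ isDown (cell (encode r c) zero j)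
  column : ∀ j → counted j ≡ shifted (hasCorner c r) j
  column zero    = trans (cong₂ _∧_ refl (isDown-encode r≺c zero zero)) (∧-zeroʳ _)
  column (suc j) = cong₂ _∧_
    (trans (anyᵇ-allFin-cong (λ i → isLeft-encode r c i (suc j))) (anyᵇ-allFin-suc (λ i → leftAt r i (suc j))))
    (isDown-encode r≺c zero (suc j))

switchTableau : Filling n k → Filling n k
switchTableau tab = encode (switch (leftColumn tab) (downRow tab)) (switch (downRow tab) (leftColumn tab))

module SwitchTableau (tab : Filling n k) (packed : T (isPackedAltTableau tab)) where
  open Decode tab (Equivalence.to (T-isPackedAltTableau tab) packed)

  switched-compatible : Compatible (switch r c) (switch c r)
  switched-compatible = switch-compatible compatible

  switchTableau-packed : T (isPackedAltTableau (switchTableau tab))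
  switchTableau-packed = Equivalence.from (T-isPackedAltTableau (switchTableau tab))
    (PackedAltTableau-resp (λ i j → sym (cell-encode _ _ i j)) (arrowAt-packed switched-compatible))

  switchTableau-involutive : switchTableau (switchTableau tab) ≡ tab
  switchTableau-involutive = trans (encode-cong left-columns down-rows) encode-decode
    where
    r≗ = leftColumn-encode (switch r c) (switch c r)
    c≗ = downRow-encode (proj₁ switched-compatible)
    left-columns : switch (leftColumn (switchTableau tab)) (downRow (switchTableau tab)) ≗ r
    left-columns i = trans (switch-cong r≗ c≗ i) (switch-involutive compatible i)
    down-rows : switch (downRow (switchTableau tab)) (leftColumn (switchTableau tab)) ≗ c
    down-rows j = trans (switch-cong c≗ r≗ j) (switch-involutive (swap compatible) j)

  wDown-switchTableau : wDown (switchTableau tab) ≡ wLeft tab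
  wDown-switchTableau = begin
    wDown (switchTableau tab)         ≡⟨ wDown-encode (proj₁ switched-compatible) ⟩
    weight (switch r c) (switch c r)  ≡⟨ weight-switch compatible ⟩
    weight c r                        ≡⟨ wLeft-encode r≺c ⟨
    wLeft (encode r c)                ≡⟨ cong wLeft encode-decode ⟩
    wLeft tab                         ∎
    where open ≡-Reasoning

-- Enumeration and sums

module _ {A : Set} where

  concatMap-cartesianProduct : ∀ {B C : Set} (f : A → B → C) (xs : List A) (ys : List B) →
                               concatMap (λ x → map (f x) ys) xs ≡ cartesianProductWith f xs ys
  concatMap-cartesianProduct f []       ys = refl
  concatMap-cartesianProduct f (x ∷ xs) ys = cong (map (f x) ys ++_) (concatMap-cartesianProduct f xs ys)

  allVecs-complete : ∀ {xs : List A} → (∀ a → a ∈ xs) → ∀ m (v : Vec.Vec A m) → v ∈ allVecs xs m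
  allVecs-complete all zero    Vec.[]       = here refl
  allVecs-complete {xs} all (suc m) (a Vec.∷ v) =
    subst (a Vec.∷ v ∈_) (sym (concatMap-cartesianProduct Vec._∷_ xs (allVecs xs m)))
          (∈-cartesianProductWith⁺ Vec._∷_ (all a) (allVecs-complete all m v))

  allVecs-unique : ∀ {xs : List A} → Unique xs → ∀ m → Unique (allVecs xs m)
  allVecs-unique unique zero    = All.[] ∷ []
  allVecs-unique {xs} unique (suc m) =
    subst Unique (sym (concatMap-cartesianProduct Vec._∷_ xs (allVecs xs m)))
          (Unique.cartesianProductWith⁺ Vec._∷_ ∷-injective unique (allVecs-unique unique m))

  map⁺-injectiveOn : ∀ {B : Set} {f : A → B} {xs} → (∀ {x y} → x ∈ xs → y ∈ xs → f x ≡ f y → x ≡ y) →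
                     Unique xs → Unique (map f xs)
  map⁺-injectiveOn {xs = []}     injective []             = []
  map⁺-injectiveOn {xs = x ∷ xs} injective (x∉xs ∷ unique) =
    All.map⁺ (All.tabulate λ y∈xs fx≡fy → All.lookup x∉xs y∈xs (injective (here refl) (there y∈xs) fx≡fy))
    ∷ map⁺-injectiveOn (λ x∈ y∈ → injective (there x∈) (there y∈)) unique

  involution-↭ : ∀ {φ : A → A} {xs} → Unique xs → (∀ {x} → x ∈ xs → φ x ∈ xs) → (∀ {x} → x ∈ xs → φ (φ x) ≡ x) →
                 map φ xs ↭ xs
  involution-↭ {φ} {xs} unique closed involutive =
    ∼bag⇒↭ (unique∧set⇒bag (map⁺-injectiveOn injective unique) unique (mk⇔ to from))
    where
    injective : ∀ {x y} → x ∈ xs → y ∈ xs → φ x ≡ φ y → x ≡ y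
    injective x∈ y∈ eq = trans (sym (involutive x∈)) (trans (cong φ eq) (involutive y∈))
    to : ∀ {y} → y ∈ map φ xs → y ∈ xs
    to y∈ with ∈-map⁻ φ y∈
    ... | x , x∈ , refl = closed x∈
    from : ∀ {y} → y ∈ xs → y ∈ map φ xs
    from y∈ = subst (_∈ map φ xs) (involutive y∈) (∈-map⁺ φ (closed y∈))

module _ (M : CommutativeMonoid 0ℓ 0ℓ) where
  open CommutativeMonoid M

  foldr-involution : ∀ {A : Set} (f g : A → Carrier) {φ : A → A} {xs} → Unique xs →
                     (∀ {x} → x ∈ xs → φ x ∈ xs) → (∀ {x} → x ∈ xs → φ (φ x) ≡ x) →
                     (∀ {x} → x ∈ xs → f x ≡ g (φ x)) →
                     foldr (λ x s → f x ∙ s) ε xs ≈ foldr (λ x s → g x ∙ s) ε xs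
  foldr-involution f g {φ} {xs} unique closed involutive f≡g∘φ = begin
    foldr (λ x s → f x ∙ s) ε xs    ≡⟨ foldr-map _∙_ f ε xs ⟨
    foldr _∙_ ε (map f xs)          ≡⟨ cong (foldr _∙_ ε) (map-cong-local (All.tabulate f≡g∘φ)) ⟩
    foldr _∙_ ε (map (g ∘ φ) xs)    ≡⟨ cong (foldr _∙_ ε) (map-∘ xs) ⟩
    foldr _∙_ ε (map g (map φ xs))  ≈⟨ foldr-commMonoid setoid isCommutativeMonoid
                                         (↭⇒↭ₛ′ isEquivalence (↭.map⁺ g (involution-↭ unique closed involutive))) ⟩
    foldr _∙_ ε (map g xs)          ≡⟨ foldr-map _∙_ g ε xs ⟩
    foldr (λ x s → g x ∙ s) ε xs    ∎
    where open ≈-Reasoning setoid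

allArrows-complete : ∀ a → a ∈ allArrows
allArrows-complete blank = here refl
allArrows-complete left  = there (here refl)
allArrows-complete down  = there (there (here refl))

allArrows-unique : Unique allArrows
allArrows-unique = ((λ ()) All.∷ (λ ()) All.∷ All.[]) ∷ ((λ ()) All.∷ All.[]) ∷ All.[] ∷ []

∈-packedAltTableaux : ∀ {tab : Filling n k} → tab ∈ packedAltTableaux n k ⇔ T (isPackedAltTableau tab)
∈-packedAltTableaux {n} {k} {tab} = mk⇔
  (proj₂ ∘ ∈-filter⁻ (T? ∘ isPackedAltTableau) {xs = allFillings n k})
  (∈-filter⁺ (T? ∘ isPackedAltTableau) (allVecs-complete (allVecs-complete allArrows-complete (suc k)) (suc n) tab))

packedAltTableaux-unique : ∀ n k → Unique (packedAltTableaux n k)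
packedAltTableaux-unique n k = Unique.filter⁺ (T? ∘ isPackedAltTableau)
  (allVecs-unique (allVecs-unique allArrows-unique (suc k)) (suc n))

theorem5p1 : (n k : ℕ) (R : CommutativeSemiring 0ℓ 0ℓ) (x : CommutativeSemiring.Carrier R) →
    CommutativeSemiring._≈_ R (genSum R n k wLeft x) (genSum R n k wDown x)
theorem5p1 n k R x =
  foldr-involution +-commutativeMonoid (pow R x ∘ wLeft) (pow R x ∘ wDown) {φ = switchTableau}
    (packedAltTableaux-unique n k) closed involutive weights
  where
  open CommutativeSemiring R using (+-commutativeMonoid)
  packed : ∀ {tab : Filling n k} → tab ∈ packedAltTableaux n k → T (isPackedAltTableau tab)
  packed = Equivalence.to ∈-packedAltTableaux
  closed : ∀ {tab} → tab ∈ packedAltTableaux n k → switchTableau tab ∈ packedAltTableaux n k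
  closed {tab} tab∈ = Equivalence.from ∈-packedAltTableaux (SwitchTableau.switchTableau-packed tab (packed tab∈))
  involutive : ∀ {tab} → tab ∈ packedAltTableaux n k → switchTableau (switchTableau tab) ≡ tab
  involutive {tab} tab∈ = SwitchTableau.switchTableau-involutive tab (packed tab∈)
  weights : ∀ {tab} → tab ∈ packedAltTableaux n k → pow R x (wLeft tab) ≡ pow R x (wDown (switchTableau tab))
  weights {tab} tab∈ = cong (pow R x) (sym (SwitchTableau.wDown-switchTableau tab (packed tab∈)))
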